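{- For every decorated tree $T$, $h(\phi_T(T))=\phi_T(h_{\mathcal T}(T))$; equivalently $h_{\mathcal T}=\phi_T^{ -1}\circ h\circ\phi_T$.
   Context: $\beta$-(1,0) trees: rooted plane trees with at least one edge, a positive integer label on every node, leaves labeled $1$, root label equal to the sum of its children's labels, other internal nodes labeled between $1$ and the sum of their children's labels; $\operatorname{root}(B)$ is the root label; $B_0$ is the one-edge tree. $\Delta_{\mathcal B}(B,i)$ ($1\le i\le\operatorname{root}(B)$): attach the root of $B$ as only child of a new root, labeling both old and new root $i$. $\oplus_{\mathcal B}(B_1,i,B_2)$ ($1\le i\le\operatorname{root}(B_1)$): add the root of $B_1$ with its subtree, relabeled $i$, as new leftmost child of the root of $B_2$, and relabel the root $i+\operatorname{root}(B_2)$. $L(B)$: add a leaf as leftmost child of the root and increase the root label by $1$. For a plane tree, the rightmost path goes from the root to the last leaf in preorder, $\operatorname{rpath}$ is its number of edges, and its nodes are numbered $1,2,\dots$ from the root. The involution $h$ on $\beta$-(1,0) trees, recursively: $h(B_0)=B_0$. If the root has a single child which is internal: let $B'$ be $B$ with its root deleted and the new root relabeled by the sum of its children's labels, and $i=\operatorname{root}(B)$; $h(B)$ is obtained from $h(B')$ by adding $1$ to the labels of the first $i$ nodes of its rightmost path and attaching a new leaf as rightmost child of the $i$-th node. If the root has $\ge2$ children and the leftmost is a leaf: let $B'$ be $B$ without that leaf and with root label decreased by $1$; $h(B)$ is $h(B')$ with a new leaf attached as child of its rightmost leaf (which becomes internal). If the root has $\ge2$ children and the leftmost is internal with label $i$: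 let $B_{hd}$ be the tree consisting of the root, relabeled $i$, its leftmost child and that child's subtree, and $B_{tl}$ the tree consisting of the root, relabeled by the sum of labels of its other children, and those children with their subtrees; $h(B)$ is obtained from $h(B_{tl})$ by replacing its rightmost leaf by the tree $h(B_{hd})$ whose root is relabeled $1$. Decorated trees: depth of the root is $0$, traversal order is preorder. A decorated tree is a rooted plane tree with at least one edge, each leaf labeled by an integer $\ge-1$, such that (1) each leaf label is strictly less than the depth of its parent; (2) every internal node of depth $p>0$ has a descendant leaf labeled $\le p-2$; (3) for every internal node $t$ of depth $p$, every subtree $T''$ rooted at a child of $t$ and every leaf $\ell$ of $T''$ labeled $p$, the leaves of $T''$ preceding $\ell$ have labels $\ge p$. Free leaves are labeled $-1$; $\operatorname{fl}(T)$ counts them. $\Pi_{\mathcal T}(T)$ (root with one child) deletes the root and subtracts $1$ from every non-free leaf label. For $T$ whose root has $\ge2$ children, $T_{hd}$ is the root with its leftmost child and that child's subtree, $T_{tl}$ the root with its other children and their subtrees. $\phi_T$ (a size-preserving bijection onto $\beta$-(1,0) trees): root with a single leaf child: $B_0$; root with a single internal child: $\Delta_{\mathcal B}(\phi_T(\Pi_{\mathcal T}(T)),\operatorname{fl}(T))$; $\ge2$ children, leftmost a leaf: $L(\phi_T(T'))$, $T'$ being $T$ without that leaf; $\ge2$ children, leftmost internal: $\oplus_{\mathcal B}(\phi_T(\Pi_{\mathcal T}(T_{hd})),\operatorname{fl}(T_{hd}),\phi_T(T_{tl}))$. $h_{\mathcal T}$ on decorated trees, recursively: if the root has a single leaf child,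 $h_{\mathcal T}(T)=T$. If the root has a single internal child: with $T'=\Pi_{\mathcal T}(T)$ and $i=\operatorname{fl}(T)$, $h_{\mathcal T}(T)$ is $h_{\mathcal T}(T')$ with a new free leaf attached as rightmost child of the $i$-th node of its rightmost path. If the root has $\ge2$ children and the leftmost is a leaf: with $T'$ being $T$ without that leaf, $h_{\mathcal T}(T)$ is $h_{\mathcal T}(T')$ with a new free leaf attached as child of its rightmost leaf (which becomes internal). If the root has $\ge2$ children and the leftmost is internal: let $T_1'=h_{\mathcal T}(T_{hd})$, $T_2'=h_{\mathcal T}(T_{tl})$, $r=\operatorname{rpath}(T_2')$ and $\ell$ the rightmost leaf of $T_2'$; add $r$ to the label of every leaf of $T_1'$ except its rightmost leaf, and replace $\ell$ in $T_2'$ by the resulting tree (its root taking the place of $\ell$). -}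

module Defs where

open import Data.Nat using (ℕ; zero; suc; _+_; _∸_; _<_)
open import Data.Integer as ℤ using (ℤ; +_; -[1+_])
open import Data.List using (List; []; _∷_; _++_; map; length; filter)
open import Data.Nat.ListAction using (sum)
open import Data.List.Relation.Unary.All using (All)
open import Data.List.Relation.Unary.Any using (Any)
open import Data.Product using (_×_)
open import Data.Empty using (⊥)
open import Data.Bool using (if_then_else_)
open import Relation.Nullary.Decidable using (⌊_⌋)
open import Relation.Binary.PropositionalEquality using (_≡_)

data BTree : Set where
  bn : ℕ → List BTree → BTree

leafB : BTree
leafB = bn 1 []

B₀ : BTree
B₀ = bn 1 (leafB ∷ [])

rootB : BTree → ℕ
rootB (bn x _) = x

childrenB : BTree → List BTree
childrenB (bn _ cs) = cs

relabelB : ℕ → BTree → BTree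
relabelB i (bn _ cs) = bn i cs

sumRoots : List BTree → ℕ
sumRoots cs = sum (map rootB cs)

ΔB : BTree → ℕ → BTree
ΔB B i = bn i (relabelB i B ∷ [])

⊕B : BTree → ℕ → BTree → BTree
⊕B B₁ i B₂ = bn (i + rootB B₂) (relabelB i B₁ ∷ childrenB B₂)

LB : BTree → BTree
LB B = bn (suc (rootB B)) (leafB ∷ childrenB B)

mutual
  sizeB : BTree → ℕ
  sizeB (bn _ cs) = suc (sizesB cs)

  sizesB : List BTree → ℕ
  sizesB [] = 0
  sizesB (c ∷ cs) = sizeB c + sizesB cs

-- add 1 to the labels of the first i nodes of the rightmost path and
-- attach a new leaf as rightmost child of the i-th node (nodes numbered from 1)
mutual
  graftB : ℕ → BTree → BTree
  graftB zero t = t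
  graftB (suc zero) (bn x cs) = bn (suc x) (cs ++ leafB ∷ [])
  graftB (suc (suc k)) (bn x cs) = bn (suc x) (graftLastB (suc k) cs)

  graftLastB : ℕ → List BTree → List BTree
  graftLastB k [] = []
  graftLastB k (c ∷ []) = graftB k c ∷ []
  graftLastB k (c ∷ cs@(_ ∷ _)) = c ∷ graftLastB k cs

mutual
  extendB : BTree → BTree
  extendB (bn x []) = bn x (leafB ∷ [])
  extendB (bn x cs@(_ ∷ _)) = bn x (extendLastB cs)

  extendLastB : List BTree → List BTree
  extendLastB [] = []
  extendLastB (c ∷ []) = extendB c ∷ []
  extendLastB (c ∷ cs@(_ ∷ _)) = c ∷ extendLastB cs

mutual
  replaceRLB : BTree → BTree → BTree
  replaceRLB s (bn x []) = s
  replaceRLB s (bn x cs@(_ ∷ _)) = bn x (replaceLastB s cs)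

  replaceLastB : BTree → List BTree → List BTree
  replaceLastB s [] = []
  replaceLastB s (c ∷ []) = replaceRLB s c ∷ []
  replaceLastB s (c ∷ cs@(_ ∷ _)) = c ∷ replaceLastB s cs

-- The involution h, with fuel (the number of nodes suffices, since every
-- recursive call is on a strictly smaller tree).
hF : ℕ → BTree → BTree
hF zero B = B
hF (suc n) (bn r []) = bn r []
hF (suc n) (bn r (bn x [] ∷ [])) = bn r (bn x [] ∷ [])
hF (suc n) (bn r (bn x ds@(_ ∷ _) ∷ [])) =
  graftB r (hF n (bn (sumRoots ds) ds))
hF (suc n) (bn r (bn x [] ∷ cs@(_ ∷ _))) =
  extendB (hF n (bn (r ∸ 1) cs))
hF (suc n) (bn r (bn x ds@(_ ∷ _) ∷ cs@(_ ∷ _))) =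
  replaceRLB (relabelB 1 (hF n (bn x (bn x ds ∷ [])))) (hF n (bn (sumRoots cs) cs))

h : BTree → BTree
h B = hF (sizeB B) B

data DTree : Set where
  lf : ℤ → DTree
  dn : List DTree → DTree

-1ℤ : ℤ
-1ℤ = -[1+ 0 ]

mutual
  leaves : DTree → List ℤ
  leaves (lf x) = x ∷ []
  leaves (dn cs) = leavesL cs

  leavesL : List DTree → List ℤ
  leavesL [] = []
  leavesL (c ∷ cs) = leaves c ++ leavesL cs

-- Well-formedness of a decorated tree, node by node; the index is the depth.
data WF : ℕ → DTree → Set where
  wf-lf : ∀ {p x} → -1ℤ ℤ.≤ x → WF p (lf x)
  wf-dn : ∀ {p c cs} →
    All (WF (suc p)) (c ∷ cs) →
    -- (1) each leaf child has label strictly less than p (the depth of this node)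
    All (λ t → ∀ x → t ≡ lf x → x ℤ.< + p) (c ∷ cs) →
    -- (2) if p > 0, some descendant leaf has label ≤ p - 2
    (0 < p → Any (λ x → x ℤ.+ + 2 ℤ.≤ + p) (leavesL (c ∷ cs))) →
    -- (3) in every child subtree, leaves preceding a leaf labelled p have labels ≥ p
    All (λ t → ∀ xs ys → leaves t ≡ xs ++ (+ p ∷ ys) → All (λ y → + p ℤ.≤ y) xs) (c ∷ cs) →
    WF p (dn (c ∷ cs))

-- A decorated tree has at least one edge (its root is internal).
IsDecorated : DTree → Set
IsDecorated (lf _) = ⊥
IsDecorated (dn cs) = WF 0 (dn cs)

mutual
  sizeD : DTree → ℕ
  sizeD (lf _) = 1
  sizeD (dn cs) = suc (sizesD cs)

  sizesD : List DTree → ℕ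
  sizesD [] = 0
  sizesD (c ∷ cs) = sizeD c + sizesD cs

-- number of free leaves (label -1)
fl : DTree → ℕ
fl T = length (filter (ℤ._≟ -1ℤ) (leaves T))

decLabel : ℤ → ℤ
decLabel x = if ⌊ x ℤ.≟ -1ℤ ⌋ then x else x ℤ.- ℤ.1ℤ

mutual
  decr : DTree → DTree
  decr (lf x) = lf (decLabel x)
  decr (dn cs) = dn (decrL cs)

  decrL : List DTree → List DTree
  decrL [] = []
  decrL (c ∷ cs) = decr c ∷ decrL cs

ΠT : DTree → DTree
ΠT (dn (c ∷ [])) = decr c
ΠT T = T

φF : ℕ → DTree → BTree
φF zero _ = B₀
φF (suc n) (lf _) = B₀
φF (suc n) (dn []) = B₀
φF (suc n) (dn (lf _ ∷ [])) = B₀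
φF (suc n) T@(dn (dn _ ∷ [])) = ΔB (φF n (ΠT T)) (fl T)
φF (suc n) (dn (lf _ ∷ rest@(_ ∷ _))) = LB (φF n (dn rest))
φF (suc n) (dn (t@(dn _) ∷ rest@(_ ∷ _))) =
  ⊕B (φF n (ΠT (dn (t ∷ [])))) (fl (dn (t ∷ []))) (φF n (dn rest))

φT : DTree → BTree
φT T = φF (sizeD T) T

mutual
  rpath : DTree → ℕ
  rpath (lf _) = 0
  rpath (dn cs) = rpathL cs

  rpathL : List DTree → ℕ
  rpathL [] = 0
  rpathL (c ∷ []) = suc (rpath c)
  rpathL (c ∷ cs@(_ ∷ _)) = rpathL cs

mutual
  graftD : ℕ → DTree → DTree
  graftD zero t = t
  graftD (suc _) (lf x) = lf x
  graftD (suc zero) (dn cs) = dn (cs ++ lf -1ℤ ∷ [])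
  graftD (suc (suc k)) (dn cs) = dn (graftLastD (suc k) cs)

  graftLastD : ℕ → List DTree → List DTree
  graftLastD k [] = []
  graftLastD k (c ∷ []) = graftD k c ∷ []
  graftLastD k (c ∷ cs@(_ ∷ _)) = c ∷ graftLastD k cs

mutual
  extendD : DTree → DTree
  extendD (lf _) = dn (lf -1ℤ ∷ [])
  extendD (dn cs) = dn (extendLastD cs)

  extendLastD : List DTree → List DTree
  extendLastD [] = []
  extendLastD (c ∷ []) = extendD c ∷ []
  extendLastD (c ∷ cs@(_ ∷ _)) = c ∷ extendLastD cs

mutual
  replaceRLD : DTree → DTree → DTree
  replaceRLD s (lf _) = s
  replaceRLD s (dn cs) = dn (replaceLastD s cs)

  replaceLastD : DTree → List DTree → List DTree
  replaceLastD s [] = []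
  replaceLastD s (c ∷ []) = replaceRLD s c ∷ []
  replaceLastD s (c ∷ cs@(_ ∷ _)) = c ∷ replaceLastD s cs

mutual
  shiftAll : ℕ → DTree → DTree
  shiftAll r (lf x) = lf (x ℤ.+ + r)
  shiftAll r (dn cs) = dn (shiftAllL r cs)

  shiftAllL : ℕ → List DTree → List DTree
  shiftAllL r [] = []
  shiftAllL r (c ∷ cs) = shiftAll r c ∷ shiftAllL r cs

mutual
  shiftButLast : ℕ → DTree → DTree
  shiftButLast r (lf x) = lf x
  shiftButLast r (dn cs) = dn (shiftButLastL r cs)

  shiftButLastL : ℕ → List DTree → List DTree
  shiftButLastL r [] = []
  shiftButLastL r (c ∷ []) = shiftButLast r c ∷ []
  shiftButLastL r (c ∷ cs@(_ ∷ _)) = shiftAll r c ∷ shiftButLastL r cs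

hTF : ℕ → DTree → DTree
hTF zero T = T
hTF (suc n) (lf x) = lf x
hTF (suc n) (dn []) = dn []
hTF (suc n) T@(dn (lf _ ∷ [])) = T
hTF (suc n) T@(dn (dn _ ∷ [])) = graftD (fl T) (hTF n (ΠT T))
hTF (suc n) (dn (lf _ ∷ rest@(_ ∷ _))) = extendD (hTF n (dn rest))
hTF (suc n) (dn (t@(dn _) ∷ rest@(_ ∷ _))) =
  let T₁' = hTF n (dn (t ∷ []))
      T₂' = hTF n (dn rest)
  in replaceRLD (shiftButLast (rpath T₂') T₁') T₂'

hT : DTree → DTree
hT T = hTF (sizeD T) T

-- h and h_T recurse along the decomposition of a tree that defines φ_T (one internal child: Δ;
-- leading leaf: L; leading internal child: ⊕), so the identity goes by induction along it. Each
-- case reduces to φ_T carrying the surgery done by h_T (graft a free leaf on the rightmost path,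
-- extend the rightmost leaf, replace the rightmost leaf by a shifted tree) to the one done by h,
-- which in turn commutes with Δ_B, L and ⊕_B. This needs h_T(T) to have a free rightmost leaf at
-- depth fl(T), an invariant carried along the induction. Only conditions (1) and (2) are used:
-- they make the leading leaf of the root free and give 1 ≤ fl(T) in the Δ case, and as Π_T does
-- not decrease the number of free leaves, the graft position stays on the rightmost path.

module Submission where

open import Data.Nat using (ℕ; zero; suc; _+_; _≤_; _<_; z≤n; s≤s)
open import Data.Nat.Properties
open import Data.Integer as ℤ using (ℤ; +_; -[1+_])
import Data.Integer.Properties as ℤP
open import Data.List using (List; []; _∷_; _++_; map; length; filter)
open import Data.List.Properties using (filter-++; length-++; map-++; ++-identityʳ; ++-assoc)
open import Data.List.Relation.Unary.All using (All; []; _∷_)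
open import Data.List.Relation.Unary.All.Properties using (++⁺)
open import Data.List.Relation.Unary.Any as Any using (Any; here; there)
import Data.List.Relation.Unary.Any.Properties as Anyₚ
open import Data.Empty using (⊥-elim)
open import Relation.Binary.PropositionalEquality
open ≡-Reasoning

open import Defs

-- Independence of the fuel

mutual
  sizeD-decr : ∀ t → sizeD (decr t) ≡ sizeD t
  sizeD-decr (lf _) = refl
  sizeD-decr (dn cs) = cong suc (sizesD-decrL cs)

  sizesD-decrL : ∀ cs → sizesD (decrL cs) ≡ sizesD cs
  sizesD-decrL [] = refl
  sizesD-decrL (c ∷ cs) = cong₂ _+_ (sizeD-decr c) (sizesD-decrL cs)

sizeD-pos : ∀ t → 1 ≤ sizeD t
sizeD-pos (lf _) = s≤s z≤n
sizeD-pos (dn _) = s≤s z≤n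

sizeB-pos : ∀ t → 1 ≤ sizeB t
sizeB-pos (bn _ _) = s≤s z≤n

size-Π : ∀ ds {n m} → suc (sizesD ds) + n ≤ m → sizeD (dn (decrL ds)) ≤ m
size-Π ds {n} {m} p = subst (_≤ m) (cong suc (sym (sizesD-decrL ds))) (≤-trans (m≤m+n _ n) p)

size-tail : ∀ a {n m} → suc a + n ≤ m → suc n ≤ m
size-tail a {n} = ≤-trans (s≤s (m≤n+m n a))

size-head : ∀ a {k n m} → 1 ≤ k → suc a + (k + n) ≤ m → suc (suc a + 0) ≤ m
size-head a {k} {n} 1≤k =
  ≤-trans (s≤s (subst (_≤ a + (k + n)) (+-suc a 0) (+-monoʳ-≤ a (≤-trans 1≤k (m≤m+n k n)))))

φF-fuel : ∀ m m' T → sizeD T ≤ m → sizeD T ≤ m' → φF m T ≡ φF m' T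
φF-fuel zero _ (lf _) () _
φF-fuel zero _ (dn _) () _
φF-fuel (suc _) zero (lf _) _ ()
φF-fuel (suc _) zero (dn _) _ ()
φF-fuel (suc m) (suc m') (lf _) _ _ = refl
φF-fuel (suc m) (suc m') (dn []) _ _ = refl
φF-fuel (suc m) (suc m') (dn (lf _ ∷ [])) _ _ = refl
φF-fuel (suc m) (suc m') T@(dn (dn ds ∷ [])) (s≤s p) (s≤s q) =
  cong (λ B → ΔB B (fl T)) (φF-fuel m m' _ (size-Π ds p) (size-Π ds q))
φF-fuel (suc m) (suc m') (dn (lf _ ∷ c ∷ cs)) (s≤s p) (s≤s q) =
  cong LB (φF-fuel m m' (dn (c ∷ cs)) p q)
φF-fuel (suc m) (suc m') (dn (t@(dn ds) ∷ c ∷ cs)) (s≤s p) (s≤s q) =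
  cong₂ (λ B₁ B₂ → ⊕B B₁ (fl (dn (t ∷ []))) B₂)
    (φF-fuel m m' _ (size-Π ds p) (size-Π ds q))
    (φF-fuel m m' (dn (c ∷ cs)) (size-tail (sizesD ds) p) (size-tail (sizesD ds) q))

hTF-fuel : ∀ m m' T → sizeD T ≤ m → sizeD T ≤ m' → hTF m T ≡ hTF m' T
hTF-fuel zero _ (lf _) () _
hTF-fuel zero _ (dn _) () _
hTF-fuel (suc _) zero (lf _) _ ()
hTF-fuel (suc _) zero (dn _) _ ()
hTF-fuel (suc m) (suc m') (lf _) _ _ = refl
hTF-fuel (suc m) (suc m') (dn []) _ _ = refl
hTF-fuel (suc m) (suc m') (dn (lf _ ∷ [])) _ _ = refl
hTF-fuel (suc m) (suc m') T@(dn (dn ds ∷ [])) (s≤s p) (s≤s q) =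
  cong (graftD (fl T)) (hTF-fuel m m' _ (size-Π ds p) (size-Π ds q))
hTF-fuel (suc m) (suc m') (dn (lf _ ∷ c ∷ cs)) (s≤s p) (s≤s q) =
  cong extendD (hTF-fuel m m' (dn (c ∷ cs)) p q)
hTF-fuel (suc m) (suc m') (dn (t@(dn ds) ∷ c ∷ cs)) (s≤s p) (s≤s q) =
  cong₂ (λ T₁ T₂ → replaceRLD (shiftButLast (rpath T₂) T₁) T₂)
    (hTF-fuel m m' (dn (t ∷ []))
      (size-head (sizesD ds) (sizeD-pos c) p) (size-head (sizesD ds) (sizeD-pos c) q))
    (hTF-fuel m m' (dn (c ∷ cs)) (size-tail (sizesD ds) p) (size-tail (sizesD ds) q))

hF-fuel : ∀ m m' B → sizeB B ≤ m → sizeB B ≤ m' → hF m B ≡ hF m' B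
hF-fuel zero _ (bn _ _) () _
hF-fuel (suc _) zero (bn _ _) _ ()
hF-fuel (suc m) (suc m') (bn _ []) _ _ = refl
hF-fuel (suc m) (suc m') (bn _ (bn _ [] ∷ [])) _ _ = refl
hF-fuel (suc m) (suc m') (bn r (bn _ ds@(_ ∷ _) ∷ [])) (s≤s p) (s≤s q) =
  cong (graftB r) (hF-fuel m m' (bn (sumRoots ds) ds) (≤-trans (m≤m+n _ 0) p) (≤-trans (m≤m+n _ 0) q))
hF-fuel (suc m) (suc m') (bn r (bn _ [] ∷ c ∷ cs)) (s≤s p) (s≤s q) =
  cong extendB (hF-fuel m m' (bn _ (c ∷ cs)) p q)
hF-fuel (suc m) (suc m') (bn r (bn x ds@(_ ∷ _) ∷ c ∷ cs)) (s≤s p) (s≤s q) =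
  cong₂ (λ B₁ B₂ → replaceRLB (relabelB 1 B₁) B₂)
    (hF-fuel m m' (bn x (bn x ds ∷ []))
      (size-head (sizesB ds) (sizeB-pos c) p) (size-head (sizesB ds) (sizeB-pos c) q))
    (hF-fuel m m' (bn (sumRoots (c ∷ cs)) (c ∷ cs)) (size-tail (sizesB ds) p) (size-tail (sizesB ds) q))

data NonEmpty {A : Set} : List A → Set where
  nonEmpty : ∀ {x xs} → NonEmpty (x ∷ xs)

data IsNode : DTree → Set where
  is-dn : ∀ cs → IsNode (dn cs)

#free : List ℤ → ℕ
#free xs = length (filter (ℤ._≟ -1ℤ) xs)

#free-++ : ∀ xs ys → #free (xs ++ ys) ≡ #free xs + #free ys
#free-++ xs ys = trans (cong length (filter-++ (ℤ._≟ -1ℤ) xs ys)) (length-++ (filter (ℤ._≟ -1ℤ) xs))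

fl-cons : ∀ c cs → fl (dn (c ∷ cs)) ≡ fl c + fl (dn cs)
fl-cons c cs = #free-++ (leaves c) (leavesL cs)

fl-single : ∀ t → fl (dn (t ∷ [])) ≡ fl t
fl-single t = trans (fl-cons t []) (+-identityʳ (fl t))

φT-Δ : ∀ t → IsNode t → φT (dn (t ∷ [])) ≡ ΔB (φT (decr t)) (fl t)
φT-Δ t@(dn ds) _ =
  cong₂ ΔB (φF-fuel _ _ (dn (decrL ds)) (size-Π ds ≤-refl) ≤-refl) (fl-single t)

-- how φ_T adds a first child to a root that already has children
prependB : DTree → BTree → BTree
prependB (lf _) B = LB B
prependB t@(dn _) B = ⊕B (φT (decr t)) (fl t) B

φT-cons : ∀ c {cs} → NonEmpty cs → φT (dn (c ∷ cs)) ≡ prependB c (φT (dn cs))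
φT-cons (lf _) nonEmpty = refl
φT-cons t@(dn ds) {c ∷ cs} nonEmpty = begin
  ⊕B (φF n (dn (decrL ds))) (fl (dn (t ∷ []))) (φF n (dn (c ∷ cs)))
    ≡⟨ cong₂ (λ B₁ B₂ → ⊕B B₁ (fl (dn (t ∷ []))) B₂)
         (φF-fuel _ _ (dn (decrL ds)) (size-Π ds ≤-refl) ≤-refl)
         (φF-fuel _ _ (dn (c ∷ cs)) (size-tail (sizesD ds) ≤-refl) ≤-refl) ⟩
  ⊕B (φT (decr t)) (fl (dn (t ∷ []))) (φT (dn (c ∷ cs)))
    ≡⟨ cong (λ i → ⊕B (φT (decr t)) i (φT (dn (c ∷ cs)))) (fl-single t) ⟩
  prependB t (φT (dn (c ∷ cs))) ∎
  where n = sizesD (t ∷ c ∷ cs)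

hT-Δ : ∀ ds → hT (dn (dn ds ∷ [])) ≡ graftD (fl (dn ds)) (hT (dn (decrL ds)))
hT-Δ ds = cong₂ graftD (fl-single (dn ds)) (hTF-fuel _ _ (dn (decrL ds)) (size-Π ds ≤-refl) ≤-refl)

hT-⊕ : ∀ ds c cs → hT (dn (dn ds ∷ c ∷ cs)) ≡
  replaceRLD (shiftButLast (rpath (hT (dn (c ∷ cs)))) (hT (dn (dn ds ∷ [])))) (hT (dn (c ∷ cs)))
hT-⊕ ds c cs = cong₂ (λ T₁ T₂ → replaceRLD (shiftButLast (rpath T₂) T₁) T₂)
  (hTF-fuel _ _ (dn (dn ds ∷ [])) (size-head (sizesD ds) (sizeD-pos c) ≤-refl) ≤-refl)
  (hTF-fuel _ _ (dn (c ∷ cs)) (size-tail (sizesD ds) ≤-refl) ≤-refl)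

-- h relabels a root by the sum of its children's labels before recursing, so unfolding it
-- through Δ_B and ⊕_B needs the root condition of β-(1,0) trees.
data RootIsSum : BTree → Set where
  root-sum : ∀ x c cs → x ≡ sumRoots (c ∷ cs) → RootIsSum (bn x (c ∷ cs))

h-ΔB : ∀ B i → RootIsSum B → h (ΔB B i) ≡ graftB i (h B)
h-ΔB _ i (root-sum _ c cs refl) =
  cong (graftB i) (hF-fuel _ _ (bn (sumRoots (c ∷ cs)) (c ∷ cs)) (m≤m+n _ 0) ≤-refl)

h-LB : ∀ B → RootIsSum B → h (LB B) ≡ extendB (h B)
h-LB _ (root-sum _ _ _ _) = refl

h-⊕B : ∀ B₁ i B₂ → RootIsSum B₁ → RootIsSum B₂ →
  h (⊕B B₁ i B₂) ≡ replaceRLB (relabelB 1 (h (ΔB B₁ i))) (h B₂)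
h-⊕B _ i _ (root-sum _ c₁ cs₁ _) (root-sum _ c₂ cs₂ refl) =
  cong₂ (λ B₁ B₂ → replaceRLB (relabelB 1 B₁) B₂)
    (hF-fuel _ _ (bn i (bn i (c₁ ∷ cs₁) ∷ []))
      (size-head (sizesB (c₁ ∷ cs₁)) (sizeB-pos c₂) ≤-refl) ≤-refl)
    (hF-fuel _ _ (bn (sumRoots (c₂ ∷ cs₂)) (c₂ ∷ cs₂)) (size-tail (sizesB (c₁ ∷ cs₁)) ≤-refl) ≤-refl)

ΔB-rootIsSum : ∀ B i → RootIsSum (ΔB B i)
ΔB-rootIsSum (bn _ cs) i = root-sum i (bn i cs) [] (sym (+-identityʳ i))

⊕B-rootIsSum : ∀ B₁ i {B} → RootIsSum B → RootIsSum (⊕B B₁ i B)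
⊕B-rootIsSum (bn _ ds) i (root-sum x c cs e) = root-sum (i + x) (bn i ds) (c ∷ cs) (cong (_+_ i) e)

prependB-rootIsSum : ∀ c {B} → RootIsSum B → RootIsSum (prependB c B)
prependB-rootIsSum (lf _) (root-sum x c cs e) = root-sum (suc x) leafB (c ∷ cs) (cong suc e)
prependB-rootIsSum t@(dn _) rs = ⊕B-rootIsSum (φT (decr t)) (fl t) rs

φT-rootIsSum : ∀ cs → RootIsSum (φT (dn cs))
φT-rootIsSum [] = root-sum 1 leafB [] refl
φT-rootIsSum (lf _ ∷ []) = root-sum 1 leafB [] refl
φT-rootIsSum (t@(dn ds) ∷ []) = subst RootIsSum (sym (φT-Δ t (is-dn ds))) (ΔB-rootIsSum _ _)
φT-rootIsSum (c ∷ cs@(_ ∷ _)) =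
  subst RootIsSum (sym (φT-cons c nonEmpty)) (prependB-rootIsSum c (φT-rootIsSum cs))

PrependCommutes : (BTree → BTree) → Set
PrependCommutes G = ∀ c B → RootIsSum B → G (prependB c B) ≡ prependB c (G B)

graftB-prepend : ∀ j → PrependCommutes (graftB (suc j))
graftB-prepend zero (lf _) (bn _ _) _ = refl
graftB-prepend zero (dn _) (bn x _) _ = cong₂ bn (sym (+-suc _ x)) refl
graftB-prepend (suc j) (lf _) _ (root-sum _ _ _ _) = refl
graftB-prepend (suc j) (dn _) _ (root-sum x _ _ _) = cong₂ bn (sym (+-suc _ x)) refl

extendB-prepend : PrependCommutes extendB
extendB-prepend (lf _) _ (root-sum _ _ _ _) = refl
extendB-prepend (dn _) _ (root-sum _ _ _ _) = refl

replaceRLB-prepend : ∀ s → PrependCommutes (replaceRLB s)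
replaceRLB-prepend s (lf _) _ (root-sum _ _ _ _) = refl
replaceRLB-prepend s (dn _) _ (root-sum _ _ _ _) = refl

graftB-ΔB : ∀ j B i → graftB (suc (suc j)) (ΔB B i) ≡ ΔB (graftB (suc j) B) (suc i)
graftB-ΔB zero (bn _ _) i = refl
graftB-ΔB (suc j) (bn _ _) i = refl

graftB-ΔB₁ : ∀ B i → graftB 1 (ΔB B i) ≡ ⊕B B i B₀
graftB-ΔB₁ (bn _ _) i = cong₂ bn (+-comm 1 i) refl

extendB-ΔB : ∀ B i → extendB (ΔB B i) ≡ ΔB (extendB B) i
extendB-ΔB (bn _ []) i = refl
extendB-ΔB (bn _ (_ ∷ _)) i = refl

replaceRLB-ΔB : ∀ s B i → RootIsSum B → replaceRLB s (ΔB B i) ≡ ΔB (replaceRLB s B) i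
replaceRLB-ΔB s _ i (root-sum _ _ _ _) = refl

φT-prepend : ∀ {G} → PrependCommutes G → ∀ c {cs es} → NonEmpty cs → NonEmpty es →
  φT (dn es) ≡ G (φT (dn cs)) → φT (dn (c ∷ es)) ≡ G (φT (dn (c ∷ cs)))
φT-prepend {G} comm c {cs} {es} ne-cs ne-es eq = begin
  φT (dn (c ∷ es))            ≡⟨ φT-cons c ne-es ⟩
  prependB c (φT (dn es))     ≡⟨ cong (prependB c) eq ⟩
  prependB c (G (φT (dn cs))) ≡⟨ sym (comm c _ (φT-rootIsSum cs)) ⟩
  G (prependB c (φT (dn cs))) ≡⟨ cong G (sym (φT-cons c ne-cs)) ⟩
  G (φT (dn (c ∷ cs)))        ∎

-- Surgery on decorated trees

data FreeOrNat : ℤ → Set where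
  free : FreeOrNat -1ℤ
  nat  : ∀ n → FreeOrNat (+ n)

data LeavesFreeOrNat : DTree → Set where
  lf-ok : ∀ {x} → FreeOrNat x → LeavesFreeOrNat (lf x)
  dn-ok : ∀ {cs} → All LeavesFreeOrNat cs → LeavesFreeOrNat (dn cs)

-- RightmostFree n t: the rightmost path of t has n edges and ends in a free leaf.
mutual
  data RightmostFree : ℕ → DTree → Set where
    lf-free : RightmostFree 0 (lf -1ℤ)
    dn-last : ∀ {n cs} → RightmostFreeL n cs → RightmostFree n (dn cs)

  data RightmostFreeL : ℕ → List DTree → Set where
    last : ∀ {n c} → RightmostFree n c → RightmostFreeL (suc n) (c ∷ [])
    skip : ∀ {n c c' cs} → RightmostFreeL n (c' ∷ cs) → RightmostFreeL n (c ∷ c' ∷ cs)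

mutual
  rightmostFree-rpath : ∀ {n t} → RightmostFree n t → rpath t ≡ n
  rightmostFree-rpath lf-free = refl
  rightmostFree-rpath (dn-last r) = rightmostFreeL-rpathL r

  rightmostFreeL-rpathL : ∀ {n cs} → RightmostFreeL n cs → rpathL cs ≡ n
  rightmostFreeL-rpathL (last r) = cong suc (rightmostFree-rpath r)
  rightmostFreeL-rpathL (skip r) = rightmostFreeL-rpathL r

mutual
  decr-rightmostFree : ∀ {n t} → RightmostFree n t → RightmostFree n (decr t)
  decr-rightmostFree lf-free = lf-free
  decr-rightmostFree (dn-last r) = dn-last (decrL-rightmostFreeL r)

  decrL-rightmostFreeL : ∀ {n cs} → RightmostFreeL n cs → RightmostFreeL n (decrL cs)
  decrL-rightmostFreeL (last r) = last (decr-rightmostFree r)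
  decrL-rightmostFreeL (skip r) = skip (decrL-rightmostFreeL r)

decrL-++ : ∀ cs ds → decrL (cs ++ ds) ≡ decrL cs ++ decrL ds
decrL-++ [] ds = refl
decrL-++ (c ∷ cs) ds = cong (decr c ∷_) (decrL-++ cs ds)

leavesL-++ : ∀ cs ds → leavesL (cs ++ ds) ≡ leavesL cs ++ leavesL ds
leavesL-++ [] ds = refl
leavesL-++ (c ∷ cs) ds =
  trans (cong (leaves c ++_) (leavesL-++ cs ds)) (sym (++-assoc (leaves c) (leavesL cs) (leavesL ds)))

mutual
  leaves-decr : ∀ t → leaves (decr t) ≡ map decLabel (leaves t)
  leaves-decr (lf _) = refl
  leaves-decr (dn cs) = leavesL-decrL cs

  leavesL-decrL : ∀ cs → leavesL (decrL cs) ≡ map decLabel (leavesL cs)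
  leavesL-decrL [] = refl
  leavesL-decrL (c ∷ cs) =
    trans (cong₂ _++_ (leaves-decr c) (leavesL-decrL cs)) (sym (map-++ decLabel (leaves c) (leavesL cs)))

graftD-isNode : ∀ j cs → IsNode (graftD (suc j) (dn cs))
graftD-isNode zero cs = is-dn _
graftD-isNode (suc j) cs = is-dn _

graftLastD-nonEmpty : ∀ k c cs → NonEmpty (graftLastD k (c ∷ cs))
graftLastD-nonEmpty k c [] = nonEmpty
graftLastD-nonEmpty k c (_ ∷ _) = nonEmpty

mutual
  decr-graftD : ∀ k t → decr (graftD k t) ≡ graftD k (decr t)
  decr-graftD zero t = refl
  decr-graftD (suc k) (lf x) = refl
  decr-graftD (suc zero) (dn cs) = cong dn (decrL-++ cs (lf -1ℤ ∷ []))
  decr-graftD (suc (suc k)) (dn cs) = cong dn (decrL-graftLastD (suc k) cs)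

  decrL-graftLastD : ∀ k cs → decrL (graftLastD k cs) ≡ graftLastD k (decrL cs)
  decrL-graftLastD k [] = refl
  decrL-graftLastD k (c ∷ []) = cong (_∷ []) (decr-graftD k c)
  decrL-graftLastD k (c ∷ cs@(_ ∷ _)) = cong (decr c ∷_) (decrL-graftLastD k cs)

mutual
  leaves-graftD : ∀ j {n t} → RightmostFree n t → j < n → leaves (graftD (suc j) t) ≡ leaves t ++ -1ℤ ∷ []
  leaves-graftD zero {t = dn cs} (dn-last _) _ = leavesL-++ cs (lf -1ℤ ∷ [])
  leaves-graftD (suc j) (dn-last r) j<n = leavesL-graftLastD j r j<n

  leavesL-graftLastD : ∀ j {n cs} → RightmostFreeL n cs → suc j < n →
    leavesL (graftLastD (suc j) cs) ≡ leavesL cs ++ -1ℤ ∷ []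
  leavesL-graftLastD j {cs = c ∷ []} (last r) (s≤s j<n) = begin
    leaves (graftD (suc j) c) ++ []  ≡⟨ ++-identityʳ _ ⟩
    leaves (graftD (suc j) c)        ≡⟨ leaves-graftD j r j<n ⟩
    leaves c ++ -1ℤ ∷ []             ≡⟨ cong (_++ -1ℤ ∷ []) (sym (++-identityʳ (leaves c))) ⟩
    (leaves c ++ []) ++ -1ℤ ∷ []     ∎
  leavesL-graftLastD j {cs = c ∷ cs} (skip r) j<n =
    trans (cong (leaves c ++_) (leavesL-graftLastD j r j<n)) (sym (++-assoc (leaves c) (leavesL cs) _))

fl-graftD : ∀ j {n t} → RightmostFree n t → j < n → fl (graftD (suc j) t) ≡ suc (fl t)
fl-graftD j {t = t} r j<n =
  trans (cong #free (leaves-graftD j r j<n)) (trans (#free-++ (leaves t) _) (+-comm (fl t) 1))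

rightmostFreeL-snoc : ∀ cs → RightmostFreeL 1 (cs ++ lf -1ℤ ∷ [])
rightmostFreeL-snoc [] = last lf-free
rightmostFreeL-snoc (_ ∷ []) = skip (last lf-free)
rightmostFreeL-snoc (_ ∷ cs@(_ ∷ _)) = skip (rightmostFreeL-snoc cs)

mutual
  rightmostFree-graftD : ∀ j {n t} → RightmostFree n t → j < n → RightmostFree (suc j) (graftD (suc j) t)
  rightmostFree-graftD zero {t = dn cs} (dn-last _) _ = dn-last (rightmostFreeL-snoc cs)
  rightmostFree-graftD (suc j) (dn-last r) j<n = dn-last (rightmostFreeL-graftLastD j r j<n)

  rightmostFreeL-graftLastD : ∀ j {n cs} → RightmostFreeL n cs → suc j < n →
    RightmostFreeL (suc (suc j)) (graftLastD (suc j) cs)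
  rightmostFreeL-graftLastD j (last r) (s≤s j<n) = last (rightmostFree-graftD j r j<n)
  rightmostFreeL-graftLastD j {cs = _ ∷ _ ∷ []} (skip r) j<n = skip (rightmostFreeL-graftLastD j r j<n)
  rightmostFreeL-graftLastD j {cs = _ ∷ _ ∷ _ ∷ _} (skip r) j<n = skip (rightmostFreeL-graftLastD j r j<n)

mutual
  leavesFreeOrNat-graftD : ∀ k {t} → LeavesFreeOrNat t → LeavesFreeOrNat (graftD k t)
  leavesFreeOrNat-graftD zero l = l
  leavesFreeOrNat-graftD (suc k) (lf-ok g) = lf-ok g
  leavesFreeOrNat-graftD (suc zero) (dn-ok ls) = dn-ok (++⁺ ls (lf-ok free ∷ []))
  leavesFreeOrNat-graftD (suc (suc k)) (dn-ok ls) = dn-ok (leavesFreeOrNat-graftLastD (suc k) ls)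

  leavesFreeOrNat-graftLastD : ∀ k {cs} → All LeavesFreeOrNat cs → All LeavesFreeOrNat (graftLastD k cs)
  leavesFreeOrNat-graftLastD k [] = []
  leavesFreeOrNat-graftLastD k (l ∷ []) = leavesFreeOrNat-graftD k l ∷ []
  leavesFreeOrNat-graftLastD k (l ∷ ls@(_ ∷ _)) = l ∷ leavesFreeOrNat-graftLastD k ls

extendLastD-nonEmpty : ∀ c cs → NonEmpty (extendLastD (c ∷ cs))
extendLastD-nonEmpty c [] = nonEmpty
extendLastD-nonEmpty c (_ ∷ _) = nonEmpty

mutual
  decr-extendD : ∀ t → decr (extendD t) ≡ extendD (decr t)
  decr-extendD (lf _) = refl
  decr-extendD (dn cs) = cong dn (decrL-extendLastD cs)

  decrL-extendLastD : ∀ cs → decrL (extendLastD cs) ≡ extendLastD (decrL cs)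
  decrL-extendLastD [] = refl
  decrL-extendLastD (c ∷ []) = cong (_∷ []) (decr-extendD c)
  decrL-extendLastD (c ∷ cs@(_ ∷ _)) = cong (decr c ∷_) (decrL-extendLastD cs)

mutual
  leaves-extendD : ∀ {n t} → RightmostFree n t → leaves (extendD t) ≡ leaves t
  leaves-extendD lf-free = refl
  leaves-extendD (dn-last r) = leavesL-extendLastD r

  leavesL-extendLastD : ∀ {n cs} → RightmostFreeL n cs → leavesL (extendLastD cs) ≡ leavesL cs
  leavesL-extendLastD (last r) = cong (_++ []) (leaves-extendD r)
  leavesL-extendLastD {cs = c ∷ _} (skip r) = cong (leaves c ++_) (leavesL-extendLastD r)

fl-extendD : ∀ {n t} → RightmostFree n t → fl (extendD t) ≡ fl t
fl-extendD r = cong #free (leaves-extendD r)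

mutual
  rightmostFree-extendD : ∀ {n t} → RightmostFree n t → RightmostFree (suc n) (extendD t)
  rightmostFree-extendD lf-free = dn-last (last lf-free)
  rightmostFree-extendD (dn-last r) = dn-last (rightmostFreeL-extendLastD r)

  rightmostFreeL-extendLastD : ∀ {n cs} → RightmostFreeL n cs → RightmostFreeL (suc n) (extendLastD cs)
  rightmostFreeL-extendLastD (last r) = last (rightmostFree-extendD r)
  rightmostFreeL-extendLastD {cs = _ ∷ _ ∷ []} (skip r) = skip (rightmostFreeL-extendLastD r)
  rightmostFreeL-extendLastD {cs = _ ∷ _ ∷ _ ∷ _} (skip r) = skip (rightmostFreeL-extendLastD r)

mutual
  leavesFreeOrNat-extendD : ∀ {t} → LeavesFreeOrNat t → LeavesFreeOrNat (extendD t)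
  leavesFreeOrNat-extendD (lf-ok _) = dn-ok (lf-ok free ∷ [])
  leavesFreeOrNat-extendD (dn-ok ls) = dn-ok (leavesFreeOrNat-extendLastD ls)

  leavesFreeOrNat-extendLastD : ∀ {cs} → All LeavesFreeOrNat cs → All LeavesFreeOrNat (extendLastD cs)
  leavesFreeOrNat-extendLastD [] = []
  leavesFreeOrNat-extendLastD (l ∷ []) = leavesFreeOrNat-extendD l ∷ []
  leavesFreeOrNat-extendLastD (l ∷ ls@(_ ∷ _)) = l ∷ leavesFreeOrNat-extendLastD ls

mutual
  shiftAll-0 : ∀ t → shiftAll 0 t ≡ t
  shiftAll-0 (lf x) = cong lf (ℤP.+-identityʳ x)
  shiftAll-0 (dn cs) = cong dn (shiftAllL-0 cs)

  shiftAllL-0 : ∀ cs → shiftAllL 0 cs ≡ cs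
  shiftAllL-0 [] = refl
  shiftAllL-0 (c ∷ cs) = cong₂ _∷_ (shiftAll-0 c) (shiftAllL-0 cs)

mutual
  shiftButLast-0 : ∀ t → shiftButLast 0 t ≡ t
  shiftButLast-0 (lf _) = refl
  shiftButLast-0 (dn cs) = cong dn (shiftButLastL-0 cs)

  shiftButLastL-0 : ∀ cs → shiftButLastL 0 cs ≡ cs
  shiftButLastL-0 [] = refl
  shiftButLastL-0 (c ∷ []) = cong (_∷ []) (shiftButLast-0 c)
  shiftButLastL-0 (c ∷ cs@(_ ∷ _)) = cong₂ _∷_ (shiftAll-0 c) (shiftButLastL-0 cs)

decLabel-shift : ∀ r {x} → FreeOrNat x → decLabel (x ℤ.+ + suc r) ≡ x ℤ.+ + r
decLabel-shift zero free = refl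
decLabel-shift (suc r) free = refl
decLabel-shift r (nat n) rewrite +-suc n r = refl

mutual
  decr-shiftAll : ∀ r {t} → LeavesFreeOrNat t → decr (shiftAll (suc r) t) ≡ shiftAll r t
  decr-shiftAll r (lf-ok g) = cong lf (decLabel-shift r g)
  decr-shiftAll r (dn-ok ls) = cong dn (decrL-shiftAllL r ls)

  decrL-shiftAllL : ∀ r {cs} → All LeavesFreeOrNat cs → decrL (shiftAllL (suc r) cs) ≡ shiftAllL r cs
  decrL-shiftAllL r [] = refl
  decrL-shiftAllL r (l ∷ ls) = cong₂ _∷_ (decr-shiftAll r l) (decrL-shiftAllL r ls)

mutual
  decr-shiftButLast : ∀ r {n t} → LeavesFreeOrNat t → RightmostFree n t →
    decr (shiftButLast (suc r) t) ≡ shiftButLast r t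
  decr-shiftButLast r (lf-ok _) lf-free = refl
  decr-shiftButLast r (dn-ok ls) (dn-last rf) = cong dn (decrL-shiftButLastL r ls rf)

  decrL-shiftButLastL : ∀ r {n cs} → All LeavesFreeOrNat cs → RightmostFreeL n cs →
    decrL (shiftButLastL (suc r) cs) ≡ shiftButLastL r cs
  decrL-shiftButLastL r (l ∷ []) (last rf) = cong (_∷ []) (decr-shiftButLast r l rf)
  decrL-shiftButLastL r (l ∷ ls) (skip rf) = cong₂ _∷_ (decr-shiftAll r l) (decrL-shiftButLastL r ls rf)

mutual
  fl-shiftAll : ∀ r {t} → LeavesFreeOrNat t → fl (shiftAll (suc r) t) ≡ 0
  fl-shiftAll r (lf-ok free) = refl
  fl-shiftAll r (lf-ok (nat _)) = refl
  fl-shiftAll r (dn-ok ls) = fl-shiftAllL r ls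

  fl-shiftAllL : ∀ r {cs} → All LeavesFreeOrNat cs → fl (dn (shiftAllL (suc r) cs)) ≡ 0
  fl-shiftAllL r [] = refl
  fl-shiftAllL r {c ∷ cs} (l ∷ ls) =
    trans (fl-cons (shiftAll (suc r) c) (shiftAllL (suc r) cs)) (cong₂ _+_ (fl-shiftAll r l) (fl-shiftAllL r ls))

mutual
  fl-shiftButLast : ∀ r {n t} → LeavesFreeOrNat t → RightmostFree n t → fl (shiftButLast (suc r) t) ≡ 1
  fl-shiftButLast r (lf-ok _) lf-free = refl
  fl-shiftButLast r (dn-ok ls) (dn-last rf) = fl-shiftButLastL r ls rf

  fl-shiftButLastL : ∀ r {n cs} → All LeavesFreeOrNat cs → RightmostFreeL n cs →
    fl (dn (shiftButLastL (suc r) cs)) ≡ 1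
  fl-shiftButLastL r {cs = c ∷ []} (l ∷ []) (last rf) =
    trans (fl-single (shiftButLast (suc r) c)) (fl-shiftButLast r l rf)
  fl-shiftButLastL r {cs = c ∷ cs} (l ∷ ls) (skip rf) =
    trans (fl-cons (shiftAll (suc r) c) (shiftButLastL (suc r) cs))
      (cong₂ _+_ (fl-shiftAll r l) (fl-shiftButLastL r ls rf))

mutual
  rightmostFree-shiftButLast : ∀ r {n t} → RightmostFree n t → RightmostFree n (shiftButLast r t)
  rightmostFree-shiftButLast r lf-free = lf-free
  rightmostFree-shiftButLast r (dn-last rf) = dn-last (rightmostFreeL-shiftButLastL r rf)

  rightmostFreeL-shiftButLastL : ∀ r {n cs} → RightmostFreeL n cs → RightmostFreeL n (shiftButLastL r cs)
  rightmostFreeL-shiftButLastL r (last rf) = last (rightmostFree-shiftButLast r rf)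
  rightmostFreeL-shiftButLastL r {cs = _ ∷ _ ∷ []} (skip rf) = skip (rightmostFreeL-shiftButLastL r rf)
  rightmostFreeL-shiftButLastL r {cs = _ ∷ _ ∷ _ ∷ _} (skip rf) = skip (rightmostFreeL-shiftButLastL r rf)

freeOrNat-shift : ∀ r {x} → FreeOrNat x → FreeOrNat (x ℤ.+ + r)
freeOrNat-shift zero free = free
freeOrNat-shift (suc r) free = nat r
freeOrNat-shift r (nat n) = nat (n + r)

mutual
  leavesFreeOrNat-shiftAll : ∀ r {t} → LeavesFreeOrNat t → LeavesFreeOrNat (shiftAll r t)
  leavesFreeOrNat-shiftAll r (lf-ok g) = lf-ok (freeOrNat-shift r g)
  leavesFreeOrNat-shiftAll r (dn-ok ls) = dn-ok (leavesFreeOrNat-shiftAllL r ls)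

  leavesFreeOrNat-shiftAllL : ∀ r {cs} → All LeavesFreeOrNat cs → All LeavesFreeOrNat (shiftAllL r cs)
  leavesFreeOrNat-shiftAllL r [] = []
  leavesFreeOrNat-shiftAllL r (l ∷ ls) = leavesFreeOrNat-shiftAll r l ∷ leavesFreeOrNat-shiftAllL r ls

mutual
  leavesFreeOrNat-shiftButLast : ∀ r {t} → LeavesFreeOrNat t → LeavesFreeOrNat (shiftButLast r t)
  leavesFreeOrNat-shiftButLast r (lf-ok g) = lf-ok g
  leavesFreeOrNat-shiftButLast r (dn-ok ls) = dn-ok (leavesFreeOrNat-shiftButLastL r ls)

  leavesFreeOrNat-shiftButLastL : ∀ r {cs} → All LeavesFreeOrNat cs → All LeavesFreeOrNat (shiftButLastL r cs)
  leavesFreeOrNat-shiftButLastL r [] = []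
  leavesFreeOrNat-shiftButLastL r (l ∷ []) = leavesFreeOrNat-shiftButLast r l ∷ []
  leavesFreeOrNat-shiftButLastL r (l ∷ ls@(_ ∷ _)) =
    leavesFreeOrNat-shiftAll r l ∷ leavesFreeOrNat-shiftButLastL r ls

replaceLastD-nonEmpty : ∀ S c cs → NonEmpty (replaceLastD S (c ∷ cs))
replaceLastD-nonEmpty S c [] = nonEmpty
replaceLastD-nonEmpty S c (_ ∷ _) = nonEmpty

mutual
  decr-replaceRLD : ∀ S t → decr (replaceRLD S t) ≡ replaceRLD (decr S) (decr t)
  decr-replaceRLD S (lf _) = refl
  decr-replaceRLD S (dn cs) = cong dn (decrL-replaceLastD S cs)

  decrL-replaceLastD : ∀ S cs → decrL (replaceLastD S cs) ≡ replaceLastD (decr S) (decrL cs)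
  decrL-replaceLastD S [] = refl
  decrL-replaceLastD S (c ∷ []) = cong (_∷ []) (decr-replaceRLD S c)
  decrL-replaceLastD S (c ∷ cs@(_ ∷ _)) = cong (decr c ∷_) (decrL-replaceLastD S cs)

mutual
  fl-replaceRLD : ∀ {S n t} → fl S ≡ 1 → RightmostFree n t → fl (replaceRLD S t) ≡ fl t
  fl-replaceRLD flS lf-free = flS
  fl-replaceRLD flS (dn-last r) = fl-replaceLastD flS r

  fl-replaceLastD : ∀ {S n cs} → fl S ≡ 1 → RightmostFreeL n cs → fl (dn (replaceLastD S cs)) ≡ fl (dn cs)
  fl-replaceLastD {S} {cs = c ∷ []} flS (last r) =
    trans (fl-single (replaceRLD S c)) (trans (fl-replaceRLD flS r) (sym (fl-single c)))
  fl-replaceLastD {S} {cs = c ∷ cs} flS (skip r) =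
    trans (fl-cons c (replaceLastD S cs))
      (trans (cong (_+_ (fl c)) (fl-replaceLastD flS r)) (sym (fl-cons c cs)))

mutual
  rightmostFree-replaceRLD : ∀ {S m n t} → RightmostFree m S → RightmostFree n t →
    RightmostFree (n + m) (replaceRLD S t)
  rightmostFree-replaceRLD rS lf-free = rS
  rightmostFree-replaceRLD rS (dn-last r) = dn-last (rightmostFreeL-replaceLastD rS r)

  rightmostFreeL-replaceLastD : ∀ {S m n cs} → RightmostFree m S → RightmostFreeL n cs →
    RightmostFreeL (n + m) (replaceLastD S cs)
  rightmostFreeL-replaceLastD rS (last r) = last (rightmostFree-replaceRLD rS r)
  rightmostFreeL-replaceLastD {cs = _ ∷ _ ∷ []} rS (skip r) = skip (rightmostFreeL-replaceLastD rS r)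
  rightmostFreeL-replaceLastD {cs = _ ∷ _ ∷ _ ∷ _} rS (skip r) = skip (rightmostFreeL-replaceLastD rS r)

mutual
  leavesFreeOrNat-replaceRLD : ∀ {S t} → LeavesFreeOrNat S → LeavesFreeOrNat t → LeavesFreeOrNat (replaceRLD S t)
  leavesFreeOrNat-replaceRLD lS (lf-ok _) = lS
  leavesFreeOrNat-replaceRLD lS (dn-ok ls) = dn-ok (leavesFreeOrNat-replaceLastD lS ls)

  leavesFreeOrNat-replaceLastD : ∀ {S cs} → LeavesFreeOrNat S → All LeavesFreeOrNat cs →
    All LeavesFreeOrNat (replaceLastD S cs)
  leavesFreeOrNat-replaceLastD lS [] = []
  leavesFreeOrNat-replaceLastD lS (l ∷ []) = leavesFreeOrNat-replaceRLD lS l ∷ []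
  leavesFreeOrNat-replaceLastD lS (l ∷ ls@(_ ∷ _)) = l ∷ leavesFreeOrNat-replaceLastD lS ls

φT-graftD : ∀ j {n cs} → RightmostFreeL n cs → j < n →
  φT (graftD (suc j) (dn cs)) ≡ graftB (suc j) (φT (dn cs))
φT-graftD zero (last lf-free) _ = refl
φT-graftD (suc _) (last lf-free) (s≤s ())
φT-graftD zero {cs = t@(dn ds) ∷ []} (last (dn-last _)) _ = begin
  φT (dn (t ∷ lf -1ℤ ∷ []))          ≡⟨ φT-cons t {lf -1ℤ ∷ []} nonEmpty ⟩
  ⊕B (φT (decr t)) (fl t) B₀         ≡⟨ sym (graftB-ΔB₁ _ _) ⟩
  graftB 1 (ΔB (φT (decr t)) (fl t)) ≡⟨ cong (graftB 1) (sym (φT-Δ t (is-dn ds))) ⟩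
  graftB 1 (φT (dn (t ∷ [])))        ∎
φT-graftD (suc j) {cs = t@(dn ds) ∷ []} (last (dn-last r)) (s≤s j<n) = begin
  φT (dn (graftD (suc j) t ∷ []))
    ≡⟨ φT-Δ (graftD (suc j) t) (graftD-isNode j ds) ⟩
  ΔB (φT (decr (graftD (suc j) t))) (fl (graftD (suc j) t))
    ≡⟨ cong₂ ΔB (cong φT (decr-graftD (suc j) t)) (fl-graftD j (dn-last r) j<n) ⟩
  ΔB (φT (graftD (suc j) (decr t))) (suc (fl t))
    ≡⟨ cong (λ B → ΔB B (suc (fl t))) (φT-graftD j (decrL-rightmostFreeL r) j<n) ⟩
  ΔB (graftB (suc j) (φT (decr t))) (suc (fl t))
    ≡⟨ sym (graftB-ΔB j _ (fl t)) ⟩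
  graftB (suc (suc j)) (ΔB (φT (decr t)) (fl t))
    ≡⟨ cong (graftB (suc (suc j))) (sym (φT-Δ t (is-dn ds))) ⟩
  graftB (suc (suc j)) (φT (dn (t ∷ []))) ∎
φT-graftD zero {cs = c ∷ _ ∷ _} (skip r) j<n =
  φT-prepend (graftB-prepend zero) c nonEmpty nonEmpty (φT-graftD zero r j<n)
φT-graftD (suc j) {cs = c ∷ c' ∷ cs} (skip r) j<n =
  φT-prepend (graftB-prepend (suc j)) c nonEmpty (graftLastD-nonEmpty (suc j) c' cs)
    (φT-graftD (suc j) r j<n)

φT-extendD : ∀ {n cs} → RightmostFreeL n cs → φT (extendD (dn cs)) ≡ extendB (φT (dn cs))
φT-extendD (last lf-free) = refl
φT-extendD {cs = t@(dn ds) ∷ []} (last (dn-last r)) = begin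
  φT (dn (extendD t ∷ []))
    ≡⟨ φT-Δ (extendD t) (is-dn _) ⟩
  ΔB (φT (decr (extendD t))) (fl (extendD t))
    ≡⟨ cong₂ ΔB (cong φT (decr-extendD t)) (fl-extendD (dn-last r)) ⟩
  ΔB (φT (extendD (decr t))) (fl t)
    ≡⟨ cong (λ B → ΔB B (fl t)) (φT-extendD (decrL-rightmostFreeL r)) ⟩
  ΔB (extendB (φT (decr t))) (fl t)
    ≡⟨ sym (extendB-ΔB _ (fl t)) ⟩
  extendB (ΔB (φT (decr t)) (fl t))
    ≡⟨ cong extendB (sym (φT-Δ t (is-dn ds))) ⟩
  extendB (φT (dn (t ∷ []))) ∎
φT-extendD {cs = c ∷ c' ∷ cs} (skip r) =
  φT-prepend extendB-prepend c nonEmpty (extendLastD-nonEmpty c' cs) (φT-extendD r)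

φT-replaceRLD : ∀ {T₁ m n cs} → LeavesFreeOrNat T₁ → RightmostFree m T₁ → IsNode T₁ → RightmostFreeL n cs →
  φT (replaceRLD (shiftButLast n T₁) (dn cs)) ≡ replaceRLB (relabelB 1 (φT T₁)) (φT (dn cs))
φT-replaceRLD {T₁} l₁ r₁ (is-dn _) (last lf-free) = begin
  φT (dn (shiftButLast 1 T₁ ∷ []))
    ≡⟨ φT-Δ (shiftButLast 1 T₁) (is-dn _) ⟩
  ΔB (φT (decr (shiftButLast 1 T₁))) (fl (shiftButLast 1 T₁))
    ≡⟨ cong₂ ΔB (cong φT (trans (decr-shiftButLast 0 l₁ r₁) (shiftButLast-0 T₁)))
                (fl-shiftButLast 0 l₁ r₁) ⟩
  ΔB (φT T₁) 1 ∎
φT-replaceRLD {T₁} {cs = t@(dn ds) ∷ []} l₁ r₁ node₁ (last {n} (dn-last r)) = begin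
  φT (dn (replaceRLD S t ∷ []))
    ≡⟨ φT-Δ (replaceRLD S t) (is-dn _) ⟩
  ΔB (φT (decr (replaceRLD S t))) (fl (replaceRLD S t))
    ≡⟨ cong₂ ΔB (cong φT decr-S) (fl-replaceRLD (fl-shiftButLast n l₁ r₁) (dn-last r)) ⟩
  ΔB (φT (replaceRLD (shiftButLast n T₁) (decr t))) (fl t)
    ≡⟨ cong (λ B → ΔB B (fl t)) (φT-replaceRLD l₁ r₁ node₁ (decrL-rightmostFreeL r)) ⟩
  ΔB (replaceRLB s (φT (decr t))) (fl t)
    ≡⟨ sym (replaceRLB-ΔB s _ (fl t) (φT-rootIsSum (decrL ds))) ⟩
  replaceRLB s (ΔB (φT (decr t)) (fl t))
    ≡⟨ cong (replaceRLB s) (sym (φT-Δ t (is-dn ds))) ⟩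
  replaceRLB s (φT (dn (t ∷ []))) ∎
  where
  S = shiftButLast (suc n) T₁
  s = relabelB 1 (φT T₁)
  decr-S : decr (replaceRLD S t) ≡ replaceRLD (shiftButLast n T₁) (decr t)
  decr-S = trans (decr-replaceRLD S t) (cong (λ X → replaceRLD X (decr t)) (decr-shiftButLast n l₁ r₁))
φT-replaceRLD {T₁} {cs = c ∷ c' ∷ cs} l₁ r₁ node₁ (skip {n} r) =
  φT-prepend (replaceRLB-prepend _) c nonEmpty (replaceLastD-nonEmpty (shiftButLast n T₁) c' cs)
    (φT-replaceRLD l₁ r₁ node₁ r)

-- Conditions (1) and (2)

LeafBelow : ℕ → DTree → Set
LeafBelow p t = ∀ x → t ≡ lf x → x ℤ.< + p

Low : ℕ → ℤ → Set
Low p x = x ℤ.+ + 2 ℤ.≤ + p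

-- WF without condition (3), which the argument never uses.
data WeakWF : ℕ → DTree → Set where
  lf-wf : ∀ {p x} → FreeOrNat x → WeakWF p (lf x)
  dn-wf : ∀ {p c cs} → All (WeakWF (suc p)) (c ∷ cs) → All (LeafBelow p) (c ∷ cs) →
    (0 < p → Any (Low p) (leavesL (c ∷ cs))) → WeakWF p (dn (c ∷ cs))

freeOrNat : ∀ {x} → -1ℤ ℤ.≤ x → FreeOrNat x
freeOrNat {+ n} _ = nat n
freeOrNat { -[1+ zero ]} _ = free
freeOrNat { -[1+ suc _ ]} (ℤ.-≤- ())

mutual
  wf⇒weakWF : ∀ {p t} → WF p t → WeakWF p t
  wf⇒weakWF (wf-lf -1≤x) = lf-wf (freeOrNat -1≤x)
  wf⇒weakWF (wf-dn ws below low _) = dn-wf (wfL⇒weakWFL ws) below low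

  wfL⇒weakWFL : ∀ {p cs} → All (WF p) cs → All (WeakWF p) cs
  wfL⇒weakWFL [] = []
  wfL⇒weakWFL (w ∷ ws) = wf⇒weakWF w ∷ wfL⇒weakWFL ws

mutual
  weakWF-leaves : ∀ {p t} → WeakWF p t → All FreeOrNat (leaves t)
  weakWF-leaves (lf-wf g) = g ∷ []
  weakWF-leaves (dn-wf ws _ _) = weakWFL-leavesL ws

  weakWFL-leavesL : ∀ {p cs} → All (WeakWF p) cs → All FreeOrNat (leavesL cs)
  weakWFL-leavesL [] = []
  weakWFL-leavesL (w ∷ ws) = ++⁺ (weakWF-leaves w) (weakWFL-leavesL ws)

freeOrNat-decLabel : ∀ {x} → FreeOrNat x → FreeOrNat (decLabel x)
freeOrNat-decLabel free = free
freeOrNat-decLabel (nat zero) = free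
freeOrNat-decLabel (nat (suc n)) = nat n

decLabel-< : ∀ {p x} → FreeOrNat x → x ℤ.< + suc p → decLabel x ℤ.< + p
decLabel-< free _ = ℤ.-<+
decLabel-< (nat zero) _ = ℤ.-<+
decLabel-< (nat (suc n)) (ℤ.+<+ (s≤s n<p)) = ℤ.+<+ n<p

low-decLabel : ∀ {p x} → Low (suc (suc p)) x → Low (suc p) (decLabel x)
low-decLabel {x = + zero} _ = ℤ.+≤+ (s≤s z≤n)
low-decLabel {x = + suc n} (ℤ.+≤+ (s≤s le)) = ℤ.+≤+ le
low-decLabel {x = -[1+ zero ]} _ = ℤ.+≤+ (s≤s z≤n)
low-decLabel {x = -[1+ suc _ ]} _ = ℤ.-≤+

leafBelow-decr : ∀ {p q t} → WeakWF q t → LeafBelow (suc p) t → LeafBelow p (decr t)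
leafBelow-decr (lf-wf g) below _ refl = decLabel-< g (below _ refl)

leafBelow-decrL : ∀ {p q cs} → All (WeakWF q) cs → All (LeafBelow (suc p)) cs → All (LeafBelow p) (decrL cs)
leafBelow-decrL [] [] = []
leafBelow-decrL (w ∷ ws) (b ∷ bs) = leafBelow-decr w b ∷ leafBelow-decrL ws bs

low-decr : ∀ p cs → (0 < suc p → Any (Low (suc p)) (leavesL cs)) → 0 < p → Any (Low p) (leavesL (decrL cs))
low-decr (suc p) cs low _ rewrite leavesL-decrL cs =
  Anyₚ.map⁺ (Any.map (λ {x} → low-decLabel {x = x}) (low (s≤s z≤n)))

mutual
  weakWF-decr : ∀ {p t} → WeakWF (suc p) t → WeakWF p (decr t)
  weakWF-decr (lf-wf g) = lf-wf (freeOrNat-decLabel g)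
  weakWF-decr {p} {dn cs} (dn-wf ws below low) =
    dn-wf (weakWFL-decrL ws) (leafBelow-decrL ws below) (low-decr p cs low)

  weakWFL-decrL : ∀ {p cs} → All (WeakWF (suc p)) cs → All (WeakWF p) (decrL cs)
  weakWFL-decrL [] = []
  weakWFL-decrL (w ∷ ws) = weakWF-decr w ∷ weakWFL-decrL ws

#free-decLabel : ∀ xs → #free xs ≤ #free (map decLabel xs)
#free-decLabel [] = z≤n
#free-decLabel (-[1+ zero ] ∷ xs) = s≤s (#free-decLabel xs)
#free-decLabel (-[1+ suc _ ] ∷ xs) = #free-decLabel xs
#free-decLabel (+ zero ∷ xs) = ≤-trans (#free-decLabel xs) (n≤1+n _)
#free-decLabel (+ suc _ ∷ xs) = #free-decLabel xs

fl-decr : ∀ t → fl t ≤ fl (decr t)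
fl-decr t = subst (fl t ≤_) (cong #free (sym (leaves-decr t))) (#free-decLabel (leaves t))

#free-pos : ∀ {xs} → All FreeOrNat xs → Any (Low 1) xs → 1 ≤ #free xs
#free-pos (free ∷ _) (here _) = s≤s z≤n
#free-pos (nat n ∷ _) (here (ℤ.+≤+ n+2≤1)) = ⊥-elim (1+n≰n (≤-trans (m≤n+m 2 n) n+2≤1))
#free-pos (free ∷ gs) (there any) = ≤-trans (#free-pos gs any) (n≤1+n _)
#free-pos (nat _ ∷ gs) (there any) = #free-pos gs any

weakWF-fl-pos : ∀ {cs} → WeakWF 1 (dn cs) → 1 ≤ fl (dn cs)
weakWF-fl-pos w@(dn-wf _ _ low) = #free-pos (weakWF-leaves w) (low (s≤s z≤n))

weakWF-leading-leaf : ∀ {x cs} → WeakWF 0 (dn (lf x ∷ cs)) → x ≡ -1ℤ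
weakWF-leading-leaf (dn-wf (lf-wf free ∷ _) _ _) = refl
weakWF-leading-leaf (dn-wf (lf-wf (nat n) ∷ _) (below ∷ _) _) with below (+ n) refl
... | ℤ.+<+ ()

weakWF-head : ∀ {c cs} → WeakWF 0 (dn (c ∷ cs)) → WeakWF 0 (dn (c ∷ []))
weakWF-head (dn-wf (w ∷ _) (b ∷ _) _) = dn-wf (w ∷ []) (b ∷ []) (λ ())

weakWF-tail : ∀ {c c' cs} → WeakWF 0 (dn (c ∷ c' ∷ cs)) → WeakWF 0 (dn (c' ∷ cs))
weakWF-tail (dn-wf (_ ∷ ws) (_ ∷ bs) _) = dn-wf ws bs (λ ())

record Invariant (T R : DTree) : Set where
  constructor mkInvariant
  field
    commutes  : h (φT T) ≡ φT R
    rightmost : RightmostFree (fl T) R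
    labels    : LeavesFreeOrNat R
    isNode    : IsNode R

invariant-Δ : ∀ {t S} i → fl t ≡ i → 1 ≤ i → i ≤ fl (decr t) → IsNode t → Invariant (decr t) S →
  Invariant (dn (t ∷ [])) (graftD i S)
invariant-Δ {t} {S} (suc j) fl≡i _ i≤n node@(is-dn ds) (mkInvariant eq rS@(dn-last rS') lS (is-dn es)) =
  mkInvariant commutes rightmost (leavesFreeOrNat-graftD (suc j) lS) (graftD-isNode j es)
  where
  commutes : h (φT (dn (t ∷ []))) ≡ φT (graftD (suc j) S)
  commutes = begin
    h (φT (dn (t ∷ [])))            ≡⟨ cong h (φT-Δ t node) ⟩
    h (ΔB (φT (decr t)) (fl t))     ≡⟨ h-ΔB _ (fl t) (φT-rootIsSum (decrL ds)) ⟩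
    graftB (fl t) (h (φT (decr t))) ≡⟨ cong₂ graftB fl≡i eq ⟩
    graftB (suc j) (φT S)           ≡⟨ sym (φT-graftD j rS' i≤n) ⟩
    φT (graftD (suc j) S)           ∎
  rightmost : RightmostFree (fl (dn (t ∷ []))) (graftD (suc j) S)
  rightmost = subst (λ k → RightmostFree k _) (sym (trans (fl-single t) fl≡i))
    (rightmostFree-graftD j rS i≤n)

invariant-L : ∀ {c cs R} → Invariant (dn (c ∷ cs)) R → Invariant (dn (lf -1ℤ ∷ c ∷ cs)) (extendD R)
invariant-L {c} {cs} {R} (mkInvariant eq rR@(dn-last rR') lR (is-dn _)) =
  mkInvariant commutes (rightmostFree-extendD rR) (leavesFreeOrNat-extendD lR) (is-dn _)
  where
  commutes : h (LB (φT (dn (c ∷ cs)))) ≡ φT (extendD R)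
  commutes = begin
    h (LB (φT (dn (c ∷ cs))))    ≡⟨ h-LB _ (φT-rootIsSum (c ∷ cs)) ⟩
    extendB (h (φT (dn (c ∷ cs)))) ≡⟨ cong extendB eq ⟩
    extendB (φT R)               ≡⟨ sym (φT-extendD rR') ⟩
    φT (extendD R)               ∎

invariant-⊕ : ∀ {t c cs S₁ S₂} → IsNode t → Invariant (dn (t ∷ [])) S₁ → Invariant (dn (c ∷ cs)) S₂ →
  Invariant (dn (t ∷ c ∷ cs)) (replaceRLD (shiftButLast (rpath S₂) S₁) S₂)
invariant-⊕ {t} {c} {cs} {S₁} {S₂} node@(is-dn ds)
  (mkInvariant eq₁ r₁ l₁ n₁) (mkInvariant eq₂ r₂@(dn-last r₂') l₂ (is-dn _)) =
  mkInvariant commutes rightmost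
    (leavesFreeOrNat-replaceRLD (leavesFreeOrNat-shiftButLast _ l₁) l₂) (is-dn _)
  where
  tl = dn (c ∷ cs)
  commutes : h (φT (dn (t ∷ c ∷ cs))) ≡ φT (replaceRLD (shiftButLast (rpath S₂) S₁) S₂)
  commutes = begin
    h (φT (dn (t ∷ c ∷ cs)))
      ≡⟨ cong h (φT-cons t {c ∷ cs} nonEmpty) ⟩
    h (⊕B (φT (decr t)) (fl t) (φT tl))
      ≡⟨ h-⊕B _ _ _ (φT-rootIsSum (decrL ds)) (φT-rootIsSum (c ∷ cs)) ⟩
    replaceRLB (relabelB 1 (h (ΔB (φT (decr t)) (fl t)))) (h (φT tl))
      ≡⟨ cong₂ (λ B₁ B₂ → replaceRLB (relabelB 1 B₁) B₂)
           (trans (cong h (sym (φT-Δ t node))) eq₁) eq₂ ⟩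
    replaceRLB (relabelB 1 (φT S₁)) (φT S₂)
      ≡⟨ sym (φT-replaceRLD l₁ r₁ n₁ r₂') ⟩
    φT (replaceRLD (shiftButLast (fl tl) S₁) S₂)
      ≡⟨ cong (λ k → φT (replaceRLD (shiftButLast k S₁) S₂)) (sym (rightmostFree-rpath r₂)) ⟩
    φT (replaceRLD (shiftButLast (rpath S₂) S₁) S₂) ∎
  fl≡ : fl tl + fl (dn (t ∷ [])) ≡ fl (dn (t ∷ c ∷ cs))
  fl≡ = trans (+-comm (fl tl) _) (trans (cong (_+ fl tl) (fl-single t)) (sym (fl-cons t (c ∷ cs))))
  rightmost : RightmostFree (fl (dn (t ∷ c ∷ cs))) (replaceRLD (shiftButLast (rpath S₂) S₁) S₂)
  rightmost = subst (λ k → RightmostFree k _) fl≡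
    (rightmostFree-replaceRLD (rightmostFree-shiftButLast _ r₁) r₂)

invariant-hT : ∀ n c cs → sizeD (dn (c ∷ cs)) ≤ n → WeakWF 0 (dn (c ∷ cs)) →
  Invariant (dn (c ∷ cs)) (hT (dn (c ∷ cs)))
invariant-hT zero _ _ () _
invariant-hT (suc _) (lf x) [] _ w with weakWF-leading-leaf w
... | refl = mkInvariant refl (dn-last (last lf-free)) (dn-ok (lf-ok free ∷ [])) (is-dn _)
invariant-hT (suc n) (lf x) (c ∷ cs) (s≤s size) w with weakWF-leading-leaf w
... | refl = invariant-L (invariant-hT n c cs size (weakWF-tail w))
invariant-hT (suc n) (dn []) _ _ (dn-wf (() ∷ _) _ _)
invariant-hT (suc n) t@(dn ds@(d ∷ ds')) [] (s≤s size) (dn-wf (w ∷ []) _ _) =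
  subst (Invariant (dn (t ∷ []))) (sym (hT-Δ ds))
    (invariant-Δ (fl t) refl (weakWF-fl-pos w) (fl-decr t) (is-dn ds)
      (invariant-hT n (decr d) (decrL ds') (size-Π ds size) (weakWF-decr w)))
invariant-hT (suc n) t@(dn ds@(_ ∷ _)) (c ∷ cs) (s≤s size) w =
  subst (Invariant (dn (t ∷ c ∷ cs))) (sym (hT-⊕ ds c cs))
    (invariant-⊕ (is-dn ds)
      (invariant-hT n t [] (size-head (sizesD ds) (sizeD-pos c) size) (weakWF-head w))
      (invariant-hT n c cs (size-tail (sizesD ds) size) (weakWF-tail w)))

proposition4p3 : (T : DTree) → IsDecorated T → h (φT T) ≡ φT (hT T)
proposition4p3 (lf _) ()
proposition4p3 (dn []) ()
proposition4p3 (dn (c ∷ cs)) wf = Invariant.commutes (invariant-hT _ c cs ≤-refl (wf⇒weakWF wf))
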